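{- For $c_0\in\mathbb{C}$, $n\ge0$ and $0\le k\le n$, \[E_{n,k}(-1,2;c_0,0)=(c_0)^{\overline n}\frac{(-\frac n2)^{\overline k}(-\frac n2+\frac12)^{\overline k}}{k!\,(\frac{c_0}2+\frac12)^{\overline k}},\qquad E_{n,k}(-1,2;c_0+1,1)=(c_0+1)^{\overline n}\frac{(-\frac n2)^{\overline k}(-\frac n2-\frac12)^{\overline k}}{k!\,(\frac{c_0}2+\frac12)^{\overline k}},\] which are nonzero only if $0\le k\le\lfloor n/2\rfloor$, resp. $0\le k\le\lfloor (n+1)/2\rfloor$. Equivalently, the $n$th row polynomials $\sum_kE_{n,k}t^k$ are $(c_0)^{\overline n}\,{}_2F_1(-\frac n2,-\frac n2+\frac12;\frac{c_0}2+\frac12\mid t)$, resp. $(c_0+1)^{\overline n}\,{}_2F_1(-\frac n2,-\frac n2-\frac12;\frac{c_0}2+\frac12\mid t)$.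
   Context: For complex parameters $(\alpha,\beta,\gamma;\alpha',\beta',\gamma')$, the GKP triangle is the unique array $T_{n,k}$, $0\le k\le n$ ($T_{n,k}=0$ if $k<0$ or $k>n$), with $T_{0,0}=1$ and $T_{n+1,k+1}=[\alpha n+\beta(k+1)+\gamma]T_{n,k+1}+[\alpha' n+\beta' k+\gamma']T_{n,k}$ for $n\ge0$, $k\ge-1$. The generalized Eulerian numbers $E_{n,k}(a,b;c_0,c_\infty)$ form the GKP triangle with parameters $(-a,b,c_0;\,a+b,-b,c_\infty)$. $x^{\overline m}=x(x+1)\cdots(x+m-1)$ ($=1$ for $m=0$), and ${}_2F_1(A,B;C\mid t)=\sum_{k\ge0}\frac{A^{\overline k}B^{\overline k}}{k!\,C^{\overline k}}t^k$ (terminating here). -}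

module Defs where

open import Level using (Level; _⊔_)
open import Data.Nat using (ℕ; suc) renaming (zero to z)
open import Algebra.Bundles using (CommutativeRing)
open import Relation.Nullary using (¬_)

module _ {c ℓ : Level} (R : CommutativeRing c ℓ) where
  open CommutativeRing R
  ι : ℕ → Carrier
  ι z    = 0#
  ι (suc n) = 1# + ι n

-- A field of characteristic 0 (stdlib has no Field bundle).  ℂ is an instance.
-- _⁻¹ is total, but only specified on nonzero elements.
record Char0Field (c ℓ : Level) : Set (Level.suc (c ⊔ ℓ)) where
  field
    commutativeRing : CommutativeRing c ℓ
  open CommutativeRing commutativeRing public hiding (zero)
  field
    _⁻¹     : Carrier → Carrier
    inverse : ∀ x → ¬ (x ≈ 0#) → x * (x ⁻¹) ≈ 1#
    char0   : ∀ n → ¬ (ι commutativeRing (suc n) ≈ 0#)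

  nat : ℕ → Carrier
  nat = ι commutativeRing

  _÷_ : Carrier → Carrier → Carrier
  x ÷ y = x * (y ⁻¹)

  half : Carrier
  half = 1# ÷ nat 2

  rise : Carrier → ℕ → Carrier
  rise x z    = 1#
  rise x (suc m) = rise x m * (x + nat m)

  -- T_{0,0}=1, T_{0,k}=0 for k>0 (so T_{n,k}=0 for k>n automatically),
  -- T_{n+1,0} = [αn+γ] T_{n,0}                       (the case k=-1, using T_{n,-1}=0)
  -- T_{n+1,k+1} = [αn+β(k+1)+γ] T_{n,k+1} + [α'n+β'k+γ'] T_{n,k}.
  GKP : (α β γ α' β' γ' : Carrier) → ℕ → ℕ → Carrier
  GKP α β γ α' β' γ' z    z    = 1#
  GKP α β γ α' β' γ' z    (suc k) = 0#
  GKP α β γ α' β' γ' (suc n) z    =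
    (α * nat n + γ) * GKP α β γ α' β' γ' n z
  GKP α β γ α' β' γ' (suc n) (suc k) =
      (α * nat n + β * nat (suc k) + γ) * GKP α β γ α' β' γ' n (suc k)
    + (α' * nat n + β' * nat k + γ') * GKP α β γ α' β' γ' n k

  Eul : (a b c₀ c∞ : Carrier) → ℕ → ℕ → Carrier
  Eul a b c₀ c∞ = GKP (- a) b c₀ (a + b) (- b) c∞

{-# OPTIONS --safe #-}
-- With x = −n−δ and b = γ−δ+1, the array k! 2ᵏ b(b+2)⋯(b+2k−2) · E_{n,k}(−1,2;γ,δ) is the
-- product γ^{\overline n} · x(x+2)⋯(x+2k−2) · (x+1)(x+3)⋯(x+2k−1): both satisfy the same
-- rescaled GKP recurrence, which reduces to one polynomial identity in γ, δ, n, k, and agree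
-- on row 0 exactly when δ ∈ {0, 1}. Halving each step-two product, x(x+2)⋯ = 2ᵏ (x/2)^{\overline k},
-- gives the hypergeometric form; and once k > ⌊(n+δ)/2⌋ one of the factors −n−δ+2j,
-- −n−δ+1+2j with j < k is zero.
module Submission where

open import Defs
open import Level using (Level)
open import Data.Nat using (ℕ; _≤_; _/_; _!) renaming (suc to 1+)
open import Data.Nat as ℕ using (zero; suc; _<_; NonZero)
open import Data.Nat.Properties using (_!≢0; ≰⇒>; m<1+n⇒m<n∨m≡n)
open import Data.Nat.DivMod using (_%_; m≡m%n+[m/n]*n; m%n<n)
open import Data.Product using (_×_; _,_; proj₁; proj₂)
open import Data.Sum using (_⊎_; inj₁; inj₂)
open import Data.Maybe using (Maybe; just; nothing)
open import Relation.Nullary using (¬_; yes; no; contradiction)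
import Relation.Binary.PropositionalEquality as ≡
open import Algebra.Bundles using (CommutativeRing; RawRing; Semiring)
import Algebra.Solver.Ring.AlmostCommutativeRing as ACR
import Algebra.Solver.Ring

-- The ring solver of the standard library, with integer coefficients (a , b) read as a − b.
module IntegerCoefficientSolver {c ℓ : Level} (R : CommutativeRing c ℓ) where
  open CommutativeRing R
  open import Relation.Binary.Reasoning.Setoid setoid
  open import Algebra.Properties.Ring ring using (-‿distribˡ-*; -‿distribʳ-*)
  open import Algebra.Properties.Group +-group using (⁻¹-involutive; ε⁻¹≈ε)
  open import Algebra.Properties.AbelianGroup +-abelianGroup using (⁻¹-∙-comm; ⁻¹-anti-homo‿-)
  open import Algebra.Properties.CommutativeSemigroup +-commutativeSemigroup using (interchange; x∙yz≈z∙yx)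

  ι-homo-+ : ∀ m n → ι R (m ℕ.+ n) ≈ ι R m + ι R n
  ι-homo-+ zero n = sym (+-identityˡ _)
  ι-homo-+ (suc m) n = trans (+-congˡ (ι-homo-+ m n)) (sym (+-assoc _ _ _))

  ι-homo-* : ∀ m n → ι R (m ℕ.* n) ≈ ι R m * ι R n
  ι-homo-* zero n = sym (zeroˡ _)
  ι-homo-* (suc m) n = begin
    ι R (n ℕ.+ m ℕ.* n)         ≈⟨ trans (ι-homo-+ n (m ℕ.* n)) (+-congˡ (ι-homo-* m n)) ⟩
    ι R n + ι R m * ι R n       ≈⟨ +-congʳ (*-identityˡ _) ⟨
    1# * ι R n + ι R m * ι R n  ≈⟨ distribʳ _ _ _ ⟨
    (1# + ι R m) * ι R n        ∎

  [x-y]+[z-w]≈[x+z]-[y+w] : ∀ x y z w → (x - y) + (z - w) ≈ (x + z) - (y + w)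
  [x-y]+[z-w]≈[x+z]-[y+w] x y z w = trans (interchange x (- y) z (- w)) (+-congˡ (⁻¹-∙-comm y w))

  x+w≈y+z⇒x-y≈z-w : ∀ {x y z w} → x + w ≈ y + z → x - y ≈ z - w
  x+w≈y+z⇒x-y≈z-w {x} {y} {z} {w} x+w≈y+z = begin
    x - y                ≈⟨ +-identityʳ _ ⟨
    (x - y) + 0#         ≈⟨ +-congˡ (-‿inverseʳ w) ⟨
    (x - y) + (w - w)    ≈⟨ [x-y]+[z-w]≈[x+z]-[y+w] x y w w ⟩
    (x + w) - (y + w)    ≈⟨ +-congʳ x+w≈y+z ⟩
    (y + z) - (y + w)    ≈⟨ [x-y]+[z-w]≈[x+z]-[y+w] y y z w ⟨
    (y - y) + (z - w)    ≈⟨ trans (+-congʳ (-‿inverseʳ y)) (+-identityˡ _) ⟩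
    z - w                ∎

  [x-y]*[z-w]≈[xz+yw]-[xw+yz] : ∀ x y z w → (x - y) * (z - w) ≈ (x * z + y * w) - (x * w + y * z)
  [x-y]*[z-w]≈[xz+yw]-[xw+yz] x y z w = begin
    (x - y) * (z - w)                                ≈⟨ trans (distribʳ _ _ _) (+-cong (distribˡ _ _ _) (distribˡ _ _ _)) ⟩
    (x * z + x * - w) + (- y * z + - y * - w)        ≈⟨ +-cong (+-congˡ (sym (-‿distribʳ-* x w))) (+-cong (sym (-‿distribˡ-* y z)) -y*-w≈yw) ⟩
    (x * z - x * w) + (- (y * z) + y * w)            ≈⟨ +-congˡ (+-comm _ _) ⟩
    (x * z - x * w) + (y * w - y * z)                ≈⟨ [x-y]+[z-w]≈[x+z]-[y+w] _ _ _ _ ⟩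
    (x * z + y * w) - (x * w + y * z)                ∎
    where
    -y*-w≈yw : - y * - w ≈ y * w
    -y*-w≈yw = trans (sym (-‿distribˡ-* y (- w))) (trans (-‿cong (sym (-‿distribʳ-* y w))) (⁻¹-involutive _))

  -- ⟦ 1 ⟧ℕ is 1# itself, so that :1 and :2 below denote 1# and nat 2 = 1# + (1# + 0#)
  -- literally and the solver's equations match the goals definitionally.
  ⟦_⟧ℕ : ℕ → Carrier
  ⟦ zero ⟧ℕ = 0#
  ⟦ suc zero ⟧ℕ = 1#
  ⟦ suc (suc n) ⟧ℕ = 1# + ⟦ suc n ⟧ℕ

  ⟦_⟧ℤ : ℕ × ℕ → Carrier
  ⟦ a , zero ⟧ℤ = ⟦ a ⟧ℕ
  ⟦ a , suc b ⟧ℤ = ⟦ a ⟧ℕ - ⟦ suc b ⟧ℕ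

  -- The solver closes goals by reflexivity on normal forms, so equal integers must have
  -- syntactically equal representatives: we keep one component of each pair zero.
  normalise : ℕ × ℕ → ℕ × ℕ
  normalise (suc a , suc b) = normalise (a , b)
  normalise p = p

  ⟦⟧ℕ≈ι : ∀ n → ⟦ n ⟧ℕ ≈ ι R n
  ⟦⟧ℕ≈ι zero = refl
  ⟦⟧ℕ≈ι (suc zero) = sym (+-identityʳ 1#)
  ⟦⟧ℕ≈ι (suc (suc n)) = +-congˡ (⟦⟧ℕ≈ι (suc n))

  ⟦⟧ℤ≈ι-ι : ∀ p → ⟦ p ⟧ℤ ≈ ι R (proj₁ p) - ι R (proj₂ p)
  ⟦⟧ℤ≈ι-ι (a , zero) = trans (⟦⟧ℕ≈ι a) (sym (trans (+-congˡ ε⁻¹≈ε) (+-identityʳ _)))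
  ⟦⟧ℤ≈ι-ι (a , suc b) = +-cong (⟦⟧ℕ≈ι a) (-‿cong (⟦⟧ℕ≈ι (suc b)))

  ⟦normalise⟧ : ∀ p → ⟦ normalise p ⟧ℤ ≈ ⟦ p ⟧ℤ
  ⟦normalise⟧ (zero , b) = refl
  ⟦normalise⟧ (suc a , zero) = refl
  ⟦normalise⟧ (suc a , suc b) = begin
    ⟦ normalise (a , b) ⟧ℤ        ≈⟨ trans (⟦normalise⟧ (a , b)) (⟦⟧ℤ≈ι-ι (a , b)) ⟩
    ι R a - ι R b                 ≈⟨ x+w≈y+z⇒x-y≈z-w (x∙yz≈z∙yx _ 1# _) ⟩
    ι R (suc a) - ι R (suc b)     ≈⟨ ⟦⟧ℤ≈ι-ι (suc a , suc b) ⟨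
    ⟦ suc a , suc b ⟧ℤ            ∎

  ℤ-rawRing : RawRing _ _
  ℤ-rawRing = record
    { Carrier = ℕ × ℕ
    ; _≈_ = ≡._≡_
    ; _+_ = λ { (a , b) (c , d) → normalise (a ℕ.+ c , b ℕ.+ d) }
    ; _*_ = λ { (a , b) (c , d) → normalise (a ℕ.* c ℕ.+ b ℕ.* d , a ℕ.* d ℕ.+ b ℕ.* c) }
    ; -_ = λ { (a , b) → (b , a) }
    ; 0# = (0 , 0)
    ; 1# = (1 , 0)
    }

  ⟦normalise⟧≈x-y : ∀ a b {x y} → ι R a ≈ x → ι R b ≈ y → ⟦ normalise (a , b) ⟧ℤ ≈ x - y
  ⟦normalise⟧≈x-y a b a≈x b≈y = trans (⟦normalise⟧ (a , b)) (trans (⟦⟧ℤ≈ι-ι (a , b)) (+-cong a≈x (-‿cong b≈y)))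

  ℤ⟶R : ℤ-rawRing ACR.-Raw-AlmostCommutative⟶ ACR.fromCommutativeRing R
  ℤ⟶R = record
    { ⟦_⟧ = ⟦_⟧ℤ
    ; +-homo = λ { (a , b) (c , d) → begin
        ⟦ normalise (a ℕ.+ c , b ℕ.+ d) ⟧ℤ         ≈⟨ ⟦normalise⟧≈x-y (a ℕ.+ c) (b ℕ.+ d) (ι-homo-+ a c) (ι-homo-+ b d) ⟩
        (ι R a + ι R c) - (ι R b + ι R d)         ≈⟨ [x-y]+[z-w]≈[x+z]-[y+w] _ _ _ _ ⟨
        (ι R a - ι R b) + (ι R c - ι R d)         ≈⟨ +-cong (sym (⟦⟧ℤ≈ι-ι (a , b))) (sym (⟦⟧ℤ≈ι-ι (c , d))) ⟩
        ⟦ a , b ⟧ℤ + ⟦ c , d ⟧ℤ                    ∎ }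
    ; *-homo = λ { (a , b) (c , d) → begin
        ⟦ normalise (a ℕ.* c ℕ.+ b ℕ.* d , a ℕ.* d ℕ.+ b ℕ.* c) ⟧ℤ
          ≈⟨ ⟦normalise⟧≈x-y (a ℕ.* c ℕ.+ b ℕ.* d) (a ℕ.* d ℕ.+ b ℕ.* c) (trans (ι-homo-+ (a ℕ.* c) (b ℕ.* d)) (+-cong (ι-homo-* a c) (ι-homo-* b d)))
               (trans (ι-homo-+ (a ℕ.* d) (b ℕ.* c)) (+-cong (ι-homo-* a d) (ι-homo-* b c))) ⟩
        (ι R a * ι R c + ι R b * ι R d) - (ι R a * ι R d + ι R b * ι R c)
          ≈⟨ [x-y]*[z-w]≈[xz+yw]-[xw+yz] _ _ _ _ ⟨
        (ι R a - ι R b) * (ι R c - ι R d)         ≈⟨ *-cong (sym (⟦⟧ℤ≈ι-ι (a , b))) (sym (⟦⟧ℤ≈ι-ι (c , d))) ⟩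
        ⟦ a , b ⟧ℤ * ⟦ c , d ⟧ℤ                    ∎ }
    ; -‿homo = λ { (a , b) → begin
        ⟦ b , a ⟧ℤ                                 ≈⟨ ⟦⟧ℤ≈ι-ι (b , a) ⟩
        ι R b - ι R a                             ≈⟨ ⁻¹-anti-homo‿- _ _ ⟨
        - (ι R a - ι R b)                         ≈⟨ -‿cong (sym (⟦⟧ℤ≈ι-ι (a , b))) ⟩
        - ⟦ a , b ⟧ℤ                               ∎ }
    ; 0-homo = refl
    ; 1-homo = refl
    }

  _≟ℤ_ : ∀ p q → Maybe (⟦ p ⟧ℤ ≈ ⟦ q ⟧ℤ)
  (a , b) ≟ℤ (c , d) with a ℕ.+ d ℕ.≟ c ℕ.+ b
  ... | no _ = nothing
  ... | yes a+d≡c+b = just (begin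
    ⟦ a , b ⟧ℤ       ≈⟨ ⟦⟧ℤ≈ι-ι (a , b) ⟩
    ι R a - ι R b    ≈⟨ x+w≈y+z⇒x-y≈z-w ι[a]+ι[d]≈ι[b]+ι[c] ⟩
    ι R c - ι R d    ≈⟨ sym (⟦⟧ℤ≈ι-ι (c , d)) ⟩
    ⟦ c , d ⟧ℤ       ∎)
    where
    ι[a]+ι[d]≈ι[b]+ι[c] : ι R a + ι R d ≈ ι R b + ι R c
    ι[a]+ι[d]≈ι[b]+ι[c] = trans (sym (ι-homo-+ a d))
      (trans (reflexive (≡.cong (ι R) a+d≡c+b)) (trans (ι-homo-+ c b) (+-comm _ _)))

  open Algebra.Solver.Ring ℤ-rawRing (ACR.fromCommutativeRing R) ℤ⟶R _≟ℤ_ public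
    using (solve; _:=_; con; _:+_; _:*_; :-_; _:-_; Polynomial)

  :0 :1 :2 : ∀ {n} → Polynomial n
  :0 = con (0 , 0)
  :1 = con (1 , 0)
  :2 = :1 :+ (:1 :+ :0)

m≡[m/2]*2⊎m≡1+[m/2]*2 : ∀ m → m ≡.≡ m / 2 ℕ.* 2 ⊎ m ≡.≡ suc (m / 2 ℕ.* 2)
m≡[m/2]*2⊎m≡1+[m/2]*2 m with m % 2 | m%n<n m 2 | m≡m%n+[m/n]*n m 2
... | zero        | _                   | m≡ = inj₁ m≡
... | suc zero    | _                   | m≡ = inj₂ m≡
... | suc (suc _) | ℕ.s≤s (ℕ.s≤s ())   | _

module _ {c ℓ : Level} (F : Char0Field c ℓ) where
  open Char0Field F
  open IntegerCoefficientSolver commutativeRing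
  open import Relation.Binary.Reasoning.Setoid setoid
  open import Algebra.Definitions.RawSemiring (Semiring.rawSemiring semiring) using (_^_)

  1≉0 : ¬ 1# ≈ 0#
  1≉0 1≈0 = char0 0 (trans (+-identityʳ 1#) 1≈0)

  ι-nonzero : ∀ n → .{{NonZero n}} → ¬ nat n ≈ 0#
  ι-nonzero (suc n) = char0 n

  x*y≉0 : ∀ {x y} → ¬ x ≈ 0# → ¬ y ≈ 0# → ¬ x * y ≈ 0#
  x*y≉0 {x} {y} x≉0 y≉0 xy≈0 = y≉0 (begin
    y               ≈⟨ *-identityˡ y ⟨
    1# * y          ≈⟨ *-congʳ (inverse x x≉0) ⟨
    x * x ⁻¹ * y    ≈⟨ trans (*-congʳ (*-comm _ _)) (*-assoc _ _ _) ⟩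
    x ⁻¹ * (x * y)  ≈⟨ *-congˡ xy≈0 ⟩
    x ⁻¹ * 0#       ≈⟨ zeroʳ _ ⟩
    0#              ∎)

  ^-nonzero : ∀ {x} k → ¬ x ≈ 0# → ¬ x ^ k ≈ 0#
  ^-nonzero zero    _   = 1≉0
  ^-nonzero (suc k) x≉0 = x*y≉0 x≉0 (^-nonzero k x≉0)

  *-cancelʳ : ∀ {x y z} → ¬ y ≈ 0# → x * y ≈ z * y → x ≈ z
  *-cancelʳ {x} {y} {z} y≉0 xy≈zy = begin
    x               ≈⟨ *-identityʳ x ⟨
    x * 1#          ≈⟨ *-congˡ (inverse y y≉0) ⟨
    x * (y * y ⁻¹)  ≈⟨ *-assoc _ _ _ ⟨
    x * y * y ⁻¹    ≈⟨ *-congʳ xy≈zy ⟩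
    z * y * y ⁻¹    ≈⟨ *-assoc _ _ _ ⟩
    z * (y * y ⁻¹)  ≈⟨ *-congˡ (inverse y y≉0) ⟩
    z * 1#          ≈⟨ *-identityʳ z ⟩
    z               ∎

  x*y≈z⇒x≈z÷y : ∀ {x y z} → ¬ y ≈ 0# → x * y ≈ z → x ≈ z ÷ y
  x*y≈z⇒x≈z÷y {x} {y} {z} y≉0 xy≈z = *-cancelʳ y≉0 (begin
    x * y           ≈⟨ xy≈z ⟩
    z               ≈⟨ *-identityʳ z ⟨
    z * 1#          ≈⟨ *-congˡ (trans (*-comm _ _) (inverse y y≉0)) ⟨
    z * (y ⁻¹ * y)  ≈⟨ *-assoc _ _ _ ⟨
    (z ÷ y) * y     ∎)

  halve : ∀ {x y} → y ≈ x * half → x ≈ nat 2 * y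
  halve {x} {y} y≈x/2 = begin
    x                   ≈⟨ *-identityʳ x ⟨
    x * 1#              ≈⟨ *-congˡ (trans (*-congˡ (*-identityˡ _)) (inverse (nat 2) (char0 1))) ⟨
    x * (nat 2 * half)  ≈⟨ solve 2 (λ x h → x :* (:2 :* h) := :2 :* (x :* h)) refl x half ⟩
    nat 2 * (x * half)  ≈⟨ *-congˡ y≈x/2 ⟨
    nat 2 * y           ∎

  rise₂ : Carrier → ℕ → Carrier
  rise₂ x zero    = 1#
  rise₂ x (suc k) = rise₂ x k * (x + nat 2 * nat k)

  rise₂-cong : ∀ {x y} k → x ≈ y → rise₂ x k ≈ rise₂ y k
  rise₂-cong zero    x≈y = refl
  rise₂-cong (suc k) x≈y = *-cong (rise₂-cong k x≈y) (+-congʳ x≈y)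

  rise₂-suc : ∀ x k → rise₂ x (suc k) ≈ x * rise₂ (x + nat 2) k
  rise₂-suc x zero = solve 1 (λ x → :1 :* (x :+ :2 :* :0) := x :* :1) refl x
  rise₂-suc x (suc k) = begin
    rise₂ x (suc k) * (x + nat 2 * nat (suc k))
      ≈⟨ *-congʳ (rise₂-suc x k) ⟩
    x * rise₂ (x + nat 2) k * (x + nat 2 * nat (suc k))
      ≈⟨ solve 3 (λ x S K → x :* S :* (x :+ :2 :* (:1 :+ K)) := x :* (S :* (x :+ :2 :+ :2 :* K)))
               refl x (rise₂ (x + nat 2) k) (nat k) ⟩
    x * (rise₂ (x + nat 2) k * (x + nat 2 + nat 2 * nat k)) ∎

  rise₂-zero : ∀ {x j} k → j < k → x + nat 2 * nat j ≈ 0# → rise₂ x k ≈ 0#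
  rise₂-zero (suc k) j<1+k factor≈0 with m<1+n⇒m<n∨m≡n j<1+k
  ... | inj₁ j<k    = trans (*-congʳ (rise₂-zero k j<k factor≈0)) (zeroˡ _)
  ... | inj₂ ≡.refl = trans (*-congˡ factor≈0) (zeroʳ _)

  rise₂-double : ∀ {x y} k → x ≈ nat 2 * y → rise₂ x k ≈ nat 2 ^ k * rise y k
  rise₂-double {x} {y} k x≈2y = trans (rise₂-cong k x≈2y) (rise₂-2y k)
    where
    rise₂-2y : ∀ k → rise₂ (nat 2 * y) k ≈ nat 2 ^ k * rise y k
    rise₂-2y zero    = sym (*-identityˡ 1#)
    rise₂-2y (suc k) = begin
      rise₂ (nat 2 * y) k * (nat 2 * y + nat 2 * nat k)  ≈⟨ *-congʳ (rise₂-2y k) ⟩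
      nat 2 ^ k * rise y k * (nat 2 * y + nat 2 * nat k)
        ≈⟨ solve 4 (λ P Q y K → P :* Q :* (:2 :* y :+ :2 :* K) := :2 :* P :* (Q :* (y :+ K)))
                 refl (nat 2 ^ k) (rise y k) y (nat k) ⟩
      nat 2 * nat 2 ^ k * (rise y k * (y + nat k))       ∎

  -- One of −m, −m+1 is −2⌊m/2⌋, so the product has the zero factor of index ⌊m/2⌋ < k.
  rise₂-vanishes : ∀ m k → m / 2 < k → rise₂ (- nat m) k * rise₂ (- nat m + 1#) k ≈ 0#
  rise₂-vanishes m k m/2<k with m≡[m/2]*2⊎m≡1+[m/2]*2 m
  ... | inj₁ m≡2q = trans (*-congʳ (rise₂-zero k m/2<k (begin
        - nat m + nat 2 * nat (m / 2)
          ≈⟨ +-congʳ (-‿cong (trans (reflexive (≡.cong nat m≡2q)) (ι-homo-* (m / 2) 2))) ⟩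
        - (nat (m / 2) * nat 2) + nat 2 * nat (m / 2)
          ≈⟨ solve 1 (λ Q → :- (Q :* :2) :+ :2 :* Q := :0) refl (nat (m / 2)) ⟩
        0# ∎))) (zeroˡ _)
  ... | inj₂ m≡1+2q = trans (*-congˡ (rise₂-zero k m/2<k (begin
        - nat m + 1# + nat 2 * nat (m / 2)
          ≈⟨ +-congʳ (+-congʳ (-‿cong (trans (reflexive (≡.cong nat m≡1+2q)) (+-congˡ (ι-homo-* (m / 2) 2))))) ⟩
        - (1# + nat (m / 2) * nat 2) + 1# + nat 2 * nat (m / 2)
          ≈⟨ solve 1 (λ Q → :- (:1 :+ Q :* :2) :+ :1 :+ :2 :* Q := :0) refl (nat (m / 2)) ⟩
        0# ∎))) (zeroʳ _)

  -- Stated for D k · T n k rather than T n k, so that D is allowed to vanish.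
  GKP-scaled : ∀ α β γ α′ β′ γ′ (D d : ℕ → Carrier) (N : ℕ → ℕ → Carrier) →
    D 0 ≈ 1# → (∀ k → D (suc k) ≈ D k * d k) →
    N 0 0 ≈ 1# → (∀ k → N 0 (suc k) ≈ 0#) →
    (∀ n → N (suc n) 0 ≈ (α * nat n + γ) * N n 0) →
    (∀ n k → N (suc n) (suc k) ≈ (α * nat n + β * nat (suc k) + γ) * N n (suc k)
                                 + (α′ * nat n + β′ * nat k + γ′) * N n k * d k) →
    ∀ n k → GKP α β γ α′ β′ γ′ n k * D k ≈ N n k
  GKP-scaled α β γ α′ β′ γ′ D d N D₀ Dₛ N₀₀ N₀ₛ Nₛ₀ Nₛₛ = go
    where
    T = GKP α β γ α′ β′ γ′
    go : ∀ n k → T n k * D k ≈ N n k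
    go zero    zero    = trans (*-identityˡ _) (trans D₀ (sym N₀₀))
    go zero    (suc k) = trans (zeroˡ _) (sym (N₀ₛ k))
    go (suc n) zero    = begin
      (α * nat n + γ) * T n 0 * D 0    ≈⟨ *-assoc _ _ _ ⟩
      (α * nat n + γ) * (T n 0 * D 0)  ≈⟨ *-congˡ (go n 0) ⟩
      (α * nat n + γ) * N n 0          ≈⟨ Nₛ₀ n ⟨
      N (suc n) 0                      ∎
    go (suc n) (suc k) = begin
      (A * T n (suc k) + B * T n k) * D (suc k)          ≈⟨ distribʳ _ _ _ ⟩
      A * T n (suc k) * D (suc k) + B * T n k * D (suc k)
        ≈⟨ +-cong (*-assoc _ _ _) (trans (*-congˡ (Dₛ k)) (sym (*-assoc _ _ _))) ⟩
      A * (T n (suc k) * D (suc k)) + B * T n k * D k * d k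
        ≈⟨ +-cong (*-congˡ (go n (suc k))) (*-congʳ (trans (*-assoc _ _ _) (*-congˡ (go n k)))) ⟩
      A * N n (suc k) + B * N n k * d k                  ≈⟨ Nₛₛ n k ⟨
      N (suc n) (suc k)                                  ∎
      where
      A = α * nat n + β * nat (suc k) + γ
      B = α′ * nat n + β′ * nat k + γ′

  -- Clears the denominators of E_{n,k}(−1,2;γ,δ) for b = γ − δ + 1.
  denominator : Carrier → ℕ → Carrier
  denominator b k = nat (k !) * (nat 2 ^ k * rise₂ b k)

  denominator-step : Carrier → ℕ → Carrier
  denominator-step b k = nat (suc k) * (nat 2 * (b + nat 2 * nat k))

  denominator-suc : ∀ b k → denominator b (suc k) ≈ denominator b k * denominator-step b k
  denominator-suc b k = begin
    nat (suc k ℕ.* k !) * (nat 2 * nat 2 ^ k * (rise₂ b k * (b + nat 2 * nat k)))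
      ≈⟨ *-congʳ (ι-homo-* (suc k) (k !)) ⟩
    nat (suc k) * nat (k !) * (nat 2 * nat 2 ^ k * (rise₂ b k * (b + nat 2 * nat k)))
      ≈⟨ solve 6 (λ K₁ F P S b K → K₁ :* F :* (:2 :* P :* (S :* (b :+ :2 :* K)))
                                  := F :* (P :* S) :* (K₁ :* (:2 :* (b :+ :2 :* K))))
               refl (nat (suc k)) (nat (k !)) (nat 2 ^ k) (rise₂ b k) b (nat k) ⟩
    denominator b k * denominator-step b k ∎

  denominator-double : ∀ {b y} k → b ≈ nat 2 * y →
    denominator b k ≈ nat (k !) * (nat 2 ^ k * (nat 2 ^ k * rise y k))
  denominator-double k b≈2y = *-congˡ (*-congˡ (rise₂-double k b≈2y))

  denominator≉0 : ∀ {b y} k → b ≈ nat 2 * y → ¬ rise y k ≈ 0# → ¬ denominator b k ≈ 0#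
  denominator≉0 k b≈2y Q≉0 D≈0 = x*y≉0 (ι-nonzero (k !) {{k !≢0}}) (x*y≉0 2ᵏ≉0 (x*y≉0 2ᵏ≉0 Q≉0))
    (trans (sym (denominator-double k b≈2y)) D≈0)
    where
    2ᵏ≉0 : ¬ nat 2 ^ k ≈ 0#
    2ᵏ≉0 = ^-nonzero k (char0 1)

  Eul-numerator : Carrier → Carrier → ℕ → ℕ → Carrier
  Eul-numerator γ δ n k = rise γ n * (rise₂ (- nat n - δ) k * rise₂ (- nat n - δ + 1#) k)

  Eul-coefficient-identity : ∀ γ δ n k →
      (- (- 1#) * nat n + nat 2 * nat (suc k) + γ)
        * ((- nat n - δ + nat 2 * nat k) * (- nat n - δ + 1# + nat 2 * nat k))
    + ((- 1# + nat 2) * nat n + - nat 2 * nat k + δ) * denominator-step (γ - δ + 1#) k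
    ≈ (γ + nat n) * ((- nat (suc n) - δ) * (- nat (suc n) - δ + 1# + nat 2 * nat k))
  Eul-coefficient-identity γ δ n k = solve 4 (λ g d N K →
        (:- (:- :1) :* N :+ :2 :* (:1 :+ K) :+ g)
          :* ((:- N :- d :+ :2 :* K) :* (:- N :- d :+ :1 :+ :2 :* K))
      :+ ((:- :1 :+ :2) :* N :+ :- :2 :* K :+ d) :* ((:1 :+ K) :* (:2 :* (g :- d :+ :1 :+ :2 :* K)))
      := (g :+ N) :* ((:- (:1 :+ N) :- d) :* (:- (:1 :+ N) :- d :+ :1 :+ :2 :* K)))
    refl γ δ (nat n) (nat k)

  Eul-numerator-step : ∀ γ δ n k →
    Eul-numerator γ δ (suc n) (suc k)
      ≈ (- (- 1#) * nat n + nat 2 * nat (suc k) + γ) * Eul-numerator γ δ n (suc k)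
        + ((- 1# + nat 2) * nat n + - nat 2 * nat k + δ) * Eul-numerator γ δ n k
          * denominator-step (γ - δ + 1#) k
  Eul-numerator-step γ δ n k = begin
    r * (γ + nat n) * (rise₂ x′ (suc k) * rise₂ (x′ + 1#) (suc k))
      ≈⟨ *-congˡ (*-cong (trans (rise₂-suc x′ k) (*-congˡ (rise₂-cong k x′+2≈x+1)))
                         (*-congʳ (rise₂-cong k x′+1≈x))) ⟩
    r * (γ + nat n) * (x′ * T * (S * y′))
      ≈⟨ solve 7 (λ r g N x′ T S y′ → r :* (g :+ N) :* (x′ :* T :* (S :* y′))
                                     := r :* (S :* T) :* ((g :+ N) :* (x′ :* y′)))
               refl r γ (nat n) x′ T S y′ ⟩
    r * (S * T) * ((γ + nat n) * (x′ * y′))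
      ≈⟨ *-congˡ (Eul-coefficient-identity γ δ n k) ⟨
    r * (S * T) * (A * ((x + nat 2 * nat k) * (x + 1# + nat 2 * nat k)) + B * d)
      ≈⟨ solve 8 (λ r S T A B x K d →
                    r :* (S :* T) :* (A :* ((x :+ :2 :* K) :* (x :+ :1 :+ :2 :* K)) :+ B :* d)
                    := A :* (r :* (S :* (x :+ :2 :* K) :* (T :* (x :+ :1 :+ :2 :* K))))
                       :+ B :* (r :* (S :* T)) :* d)
               refl r S T A B x (nat k) d ⟩
    A * Eul-numerator γ δ n (suc k) + B * Eul-numerator γ δ n k * d ∎
    where
    r  = rise γ n
    x  = - nat n - δ
    x′ = - nat (suc n) - δ
    y′ = x′ + 1# + nat 2 * nat k
    S  = rise₂ x k
    T  = rise₂ (x + 1#) k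
    A  = - (- 1#) * nat n + nat 2 * nat (suc k) + γ
    B  = (- 1# + nat 2) * nat n + - nat 2 * nat k + δ
    d  = denominator-step (γ - δ + 1#) k
    x′+2≈x+1 : x′ + nat 2 ≈ x + 1#
    x′+2≈x+1 = solve 2 (λ N d → :- (:1 :+ N) :- d :+ :2 := :- N :- d :+ :1) refl (nat n) δ
    x′+1≈x : x′ + 1# ≈ x
    x′+1≈x = solve 2 (λ N d → :- (:1 :+ N) :- d :+ :1 := :- N :- d) refl (nat n) δ

  -- The two families of the theorem are δ = 0 and δ = 1 (with γ = c₀ resp. c₀ + 1): the
  -- hypothesis on δ is exactly what makes row 0 of the numerator vanish beyond k = 0.
  Eul-scaled : ∀ γ δ → δ * (δ - 1#) ≈ 0# → ∀ n k →
    Eul (- 1#) (nat 2) γ δ n k * denominator (γ - δ + 1#) k ≈ Eul-numerator γ δ n k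
  Eul-scaled γ δ δ[δ-1]≈0 =
    GKP-scaled (- (- 1#)) (nat 2) γ (- 1# + nat 2) (- nat 2) δ
      (denominator b) (denominator-step b) (Eul-numerator γ δ)
      (solve 0 ((:1 :+ :0) :* (:1 :* :1) := :1) refl) (denominator-suc b)
      (trans (*-identityˡ _) (*-identityˡ 1#)) row₀ column₀ (Eul-numerator-step γ δ)
    where
    b = γ - δ + 1#
    x₀ = - nat 0 - δ

    row₀ : ∀ k → Eul-numerator γ δ 0 (suc k) ≈ 0#
    row₀ k = begin
      1# * (rise₂ x₀ (suc k) * rise₂ (x₀ + 1#) (suc k))
        ≈⟨ trans (*-identityˡ _) (*-cong (rise₂-suc x₀ k) (rise₂-suc (x₀ + 1#) k)) ⟩
      x₀ * S * ((x₀ + 1#) * T)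
        ≈⟨ solve 3 (λ x S T → x :* S :* ((x :+ :1) :* T) := x :* (x :+ :1) :* (S :* T)) refl x₀ S T ⟩
      x₀ * (x₀ + 1#) * (S * T)
        ≈⟨ *-congʳ (solve 1 (λ d → (:- :0 :- d) :* (:- :0 :- d :+ :1) := d :* (d :- :1)) refl δ) ⟩
      δ * (δ - 1#) * (S * T)  ≈⟨ *-congʳ δ[δ-1]≈0 ⟩
      0# * (S * T)            ≈⟨ zeroˡ _ ⟩
      0#                      ∎
      where
      S = rise₂ (x₀ + nat 2) k
      T = rise₂ (x₀ + 1# + nat 2) k

    column₀ : ∀ n → Eul-numerator γ δ (suc n) 0 ≈ (- (- 1#) * nat n + γ) * Eul-numerator γ δ n 0
    column₀ n = solve 3 (λ g r N → r :* (g :+ N) :* (:1 :* :1) := (:- (:- :1) :* N :+ g) :* (r :* (:1 :* :1)))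
                  refl γ (rise γ n) (nat n)

  Eul-closed-form : ∀ γ δ y a b n k → δ * (δ - 1#) ≈ 0# → ¬ rise y k ≈ 0# →
    γ - δ + 1# ≈ nat 2 * y → - nat n - δ ≈ nat 2 * a → - nat n - δ + 1# ≈ nat 2 * b →
    Eul (- 1#) (nat 2) γ δ n k ≈ rise γ n * ((rise a k * rise b k) ÷ (nat (k !) * rise y k))
  Eul-closed-form γ δ y a b n k δ[δ-1]≈0 Q≉0 c≈2y u≈2a v≈2b = begin
    E                                     ≈⟨ x*y≈z⇒x≈z÷y (x*y≉0 k!≉0 Q≉0) (*-cancelʳ (x*y≉0 p≉0 p≉0) scaled) ⟩
    (r * (A * B)) ÷ (nat (k !) * Q)       ≈⟨ *-assoc _ _ _ ⟩
    r * ((A * B) ÷ (nat (k !) * Q))       ∎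
    where
    E = Eul (- 1#) (nat 2) γ δ n k
    r = rise γ n
    p = nat 2 ^ k
    A = rise a k
    B = rise b k
    Q = rise y k
    k!≉0 : ¬ nat (k !) ≈ 0#
    k!≉0 = ι-nonzero (k !) {{k !≢0}}
    p≉0 : ¬ p ≈ 0#
    p≉0 = ^-nonzero k (char0 1)
    scaled : E * (nat (k !) * Q) * (p * p) ≈ r * (A * B) * (p * p)
    scaled = begin
      E * (nat (k !) * Q) * (p * p)
        ≈⟨ solve 4 (λ E F Q p → E :* (F :* Q) :* (p :* p) := E :* (F :* (p :* (p :* Q)))) refl E (nat (k !)) Q p ⟩
      E * (nat (k !) * (p * (p * Q)))                                   ≈⟨ *-congˡ (denominator-double k c≈2y) ⟨
      E * denominator (γ - δ + 1#) k                                    ≈⟨ Eul-scaled γ δ δ[δ-1]≈0 n k ⟩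
      r * (rise₂ (- nat n - δ) k * rise₂ (- nat n - δ + 1#) k)           ≈⟨ *-congˡ (*-cong (rise₂-double k u≈2a) (rise₂-double k v≈2b)) ⟩
      r * (p * A * (p * B))
        ≈⟨ solve 4 (λ r p A B → r :* (p :* A :* (p :* B)) := r :* (A :* B) :* (p :* p)) refl r p A B ⟩
      r * (A * B) * (p * p)                                             ∎

  Eul-support : ∀ γ δ y m n k → δ * (δ - 1#) ≈ 0# → ¬ rise y k ≈ 0# →
    γ - δ + 1# ≈ nat 2 * y → - nat n - δ ≈ - nat m →
    ¬ Eul (- 1#) (nat 2) γ δ n k ≈ 0# → k ≤ m / 2
  Eul-support γ δ y m n k δ[δ-1]≈0 Q≉0 c≈2y x≈-m E≉0 with k ℕ.≤? m / 2
  ... | yes k≤m/2 = k≤m/2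
  ... | no  k≰m/2 = contradiction (*-cancelʳ (denominator≉0 k c≈2y Q≉0) E·D≈0·D) E≉0
    where
    E·D≈0·D : Eul (- 1#) (nat 2) γ δ n k * denominator (γ - δ + 1#) k ≈ 0# * denominator (γ - δ + 1#) k
    E·D≈0·D = begin
      Eul (- 1#) (nat 2) γ δ n k * denominator (γ - δ + 1#) k  ≈⟨ Eul-scaled γ δ δ[δ-1]≈0 n k ⟩
      rise γ n * (rise₂ (- nat n - δ) k * rise₂ (- nat n - δ + 1#) k)
        ≈⟨ *-congˡ (*-cong (rise₂-cong k x≈-m) (rise₂-cong k (+-congʳ x≈-m))) ⟩
      rise γ n * (rise₂ (- nat m) k * rise₂ (- nat m + 1#) k)   ≈⟨ *-congˡ (rise₂-vanishes m k (≰⇒> k≰m/2)) ⟩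
      rise γ n * 0#                                             ≈⟨ zeroʳ _ ⟩
      0#                                                        ≈⟨ zeroˡ _ ⟨
      0# * denominator (γ - δ + 1#) k                           ∎

theorem4p19 : ∀ {c ℓ : Level} (F : Char0Field c ℓ) → let open Char0Field F in
  (c₀ : Carrier) (n k : ℕ) → k ≤ n →
  ¬ (rise (c₀ * half + half) k ≈ 0#) →
    (Eul (- 1#) (nat 2) c₀ 0# n k
       ≈ rise c₀ n * ((rise (- (nat n * half)) k * rise (- (nat n * half) + half) k)
           ÷ (nat (k !) * rise (c₀ * half + half) k)))
  × (Eul (- 1#) (nat 2) (c₀ + 1#) 1# n k
       ≈ rise (c₀ + 1#) n * ((rise (- (nat n * half)) k * rise (- (nat n * half) - half) k)
           ÷ (nat (k !) * rise (c₀ * half + half) k)))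
  × (¬ (Eul (- 1#) (nat 2) c₀ 0# n k ≈ 0#) → k ≤ n / 2)
  × (¬ (Eul (- 1#) (nat 2) (c₀ + 1#) 1# n k ≈ 0#) → k ≤ 1+ n / 2)
theorem4p19 F c₀ n k _ Q≉0 =
    Eul-closed-form F c₀ 0# y a b n k δ₀ Q≉0 y₀ a₀ b₀
  , trans (Eul-closed-form F (c₀ + 1#) 1# y a′ a n k δ₁ Q≉0 y₁ a′₁ a₁) (*-congˡ (*-congʳ (*-comm _ _)))
  , Eul-support F c₀ 0# y n n k δ₀ Q≉0 y₀ (solve 1 (λ N → :- N :- :0 := :- N) refl (nat n))
  , Eul-support F (c₀ + 1#) 1# y (suc n) n k δ₁ Q≉0 y₁ (solve 1 (λ N → :- N :- :1 := :- (:1 :+ N)) refl (nat n))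
  where
  open Char0Field F
  open IntegerCoefficientSolver commutativeRing
  y  = c₀ * half + half
  a  = - (nat n * half)
  b  = - (nat n * half) + half
  a′ = - (nat n * half) - half
  δ₀ : 0# * (0# - 1#) ≈ 0#
  δ₀ = zeroˡ _
  δ₁ : 1# * (1# - 1#) ≈ 0#
  δ₁ = trans (*-identityˡ _) (-‿inverseʳ 1#)
  y₀ : c₀ - 0# + 1# ≈ nat 2 * y
  y₀ = halve F (solve 2 (λ c h → c :* h :+ h := (c :- :0 :+ :1) :* h) refl c₀ half)
  y₁ : c₀ + 1# - 1# + 1# ≈ nat 2 * y
  y₁ = halve F (solve 2 (λ c h → c :* h :+ h := (c :+ :1 :- :1 :+ :1) :* h) refl c₀ half)
  a₀ : - nat n - 0# ≈ nat 2 * a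
  a₀ = halve F (solve 2 (λ N h → :- (N :* h) := (:- N :- :0) :* h) refl (nat n) half)
  b₀ : - nat n - 0# + 1# ≈ nat 2 * b
  b₀ = halve F (solve 2 (λ N h → :- (N :* h) :+ h := (:- N :- :0 :+ :1) :* h) refl (nat n) half)
  a′₁ : - nat n - 1# ≈ nat 2 * a′
  a′₁ = halve F (solve 2 (λ N h → :- (N :* h) :- h := (:- N :- :1) :* h) refl (nat n) half)
  a₁ : - nat n - 1# + 1# ≈ nat 2 * a
  a₁ = halve F (solve 2 (λ N h → :- (N :* h) := (:- N :- :1 :+ :1) :* h) refl (nat n) half)
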